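{- Let $K\subseteq H$ be strongly connected subgraphs of $G_n$. If $K$ is driftless, then $H$ is driftless.
   Context: $[n]=\{1,\dots,n\}$. For distinct reals $y_1,\dots,y_n$, $\mathrm{Order}(y_1,\dots,y_n)$ is the unique $\sigma\in S_n$ with $y_i<y_j$ iff $\sigma(i)<\sigma(j)$. $\rho,\rho':S_{n+1}\to S_n$: $\rho(\sigma)=\mathrm{Order}(\sigma(1),\dots,\sigma(n))$, $\rho'(\sigma)=\mathrm{Order}(\sigma(2),\dots,\sigma(n+1))$. The permutation digraph $G_n$ has vertex set $S_n$ and edge set $S_{n+1}$, the edge $e$ directed from $\rho(e)$ to $\rho'(e)$. A path of length $\ell$ is $(v_0,e_1,v_1,\dots,e_\ell,v_\ell)$ with $e_i$ directed from $v_{i-1}$ to $v_i$; a loop based at $v_0$ is a finite path of length $\ge 1$ with $v_\ell=v_0$. For a path $p$ of length $\ell$ in $G_n$ let $Q_p=\{x_1,\dots,x_{\ell+n}\}$ with $\le$ the reflexive-transitive closure of: $x_{a+c}\le x_{a+d}$ when $0\le a\le\ell$, $c,d\in[n]$, $v_a(c)\le v_a(d)$; $x_{a-1+c}\le x_{a-1+d}$ when $1\le a\le\ell$, $c,d\in[n+1]$, $e_a(c)\le e_a(d)$. For a loop $\gamma$ of length $\ell$ and $j\in[n]$, $\mathrm{Drift}_\gamma(j)=+$ if $x_j\le x_{\ell+j}$, $-$ if $x_j\ge x_{\ell+j}$, $0$ otherwise. A strongly connected subgraph $H$ drifts if there exist a vertex $v$ of $H$, $j\in[n]$ and $\epsilon\in\{+,-\}$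 such that every loop $\gamma$ in $H$ based at $v$ has $\mathrm{Drift}_\gamma(j)=\epsilon$; otherwise $H$ is driftless. -}

module Defs where

open import Data.Nat as ℕ using (ℕ; zero; suc)
open import Data.Fin as Fin using (Fin; toℕ; inject₁; fromℕ)
open import Data.Vec using (Vec; lookup)
open import Data.Product using (Σ; ∃; ∃-syntax; _×_; _,_)
open import Relation.Nullary using (¬_)
open import Relation.Binary.PropositionalEquality using (_≡_)
open import Relation.Binary.Construct.Closure.ReflexiveTransitive using (Star)
open import Function.Bundles using (_⇔_)

-- Conventions: everything is 0-based.  [n] is Fin n; a permutation σ ∈ S_n is
-- a vector of length n with entries in Fin n whose lookup is injective.

Injective-lookup : ∀ {m} → Vec (Fin m) m → Set
Injective-lookup {m} σ = ∀ (i j : Fin m) → lookup σ i ≡ lookup σ j → i ≡ j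

IsPerm : ∀ {m} → Vec (Fin m) m → Set
IsPerm σ = Injective-lookup σ

IsOrder : ∀ {n k} → Vec (Fin n) n → (Fin n → Fin k) → Set
IsOrder {n} σ y = IsPerm σ × (∀ (i j : Fin n) → ((y i Fin.< y j) ⇔ (lookup σ i Fin.< lookup σ j)))

-- Vertices of G_n : Vec (Fin n) n (perms);  edges : Vec (Fin (suc n)) (suc n) (perms in S_{n+1}).
Vert : ℕ → Set
Vert n = Vec (Fin n) n

Edge : ℕ → Set
Edge n = Vec (Fin (suc n)) (suc n)

IsRho : ∀ {n} → Edge n → Vert n → Set
IsRho e u = IsOrder u (λ i → lookup e (inject₁ i))

IsRho' : ∀ {n} → Edge n → Vert n → Set
IsRho' e w = IsOrder w (λ i → lookup e (Fin.suc i))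

EdgeFromTo : ∀ {n} → Edge n → Vert n → Vert n → Set
EdgeFromTo e u w = IsPerm e × IsRho e u × IsRho' e w

record Subgraph (n : ℕ) : Set₁ where
  field
    V : Vert n → Set
    E : Edge n → Set
    V-perm : ∀ v → V v → IsPerm v
    E-perm : ∀ e → E e → IsPerm e
    E-ends : ∀ e u w → E e → EdgeFromTo e u w → V u × V w
open Subgraph public

_⊆G_ : ∀ {n} → Subgraph n → Subgraph n → Set
K ⊆G H = (∀ v → V K v → V H v) × (∀ e → E K e → E H e)

-- A path of length ℓ in H: vertices v_0..v_ℓ and edges e_1..e_ℓ (0-based indices),
-- e_{i+1} directed from v_i to v_{i+1}.
record Path {n} (H : Subgraph n) (ℓ : ℕ) : Set where
  field
    verts : Fin (suc ℓ) → Vert n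
    edges : Fin ℓ → Edge n
    verts-in : ∀ a → V H (verts a)
    edges-in : ∀ i → E H (edges i)
    incid : ∀ i → EdgeFromTo (edges i) (verts (inject₁ i)) (verts (Fin.suc i))
open Path public

start : ∀ {n H ℓ} → Path {n} H ℓ → Vert n
start p = verts p Fin.zero

end : ∀ {n H ℓ} → Path {n} H ℓ → Vert n
end {ℓ = ℓ} p = verts p (fromℕ ℓ)

-- Generating relations of Q_p, on the (0-based) indices 0..ℓ+n-1 of x_1..x_{ℓ+n}.
data Gen {n ℓ} {H : Subgraph n} (p : Path H ℓ) : ℕ → ℕ → Set where
  gen-v : ∀ (a : Fin (suc ℓ)) (c d : Fin n) →
          lookup (verts p a) c Fin.≤ lookup (verts p a) d →
          Gen p (toℕ a ℕ.+ toℕ c) (toℕ a ℕ.+ toℕ d)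
  gen-e : ∀ (i : Fin ℓ) (c d : Fin (suc n)) →
          lookup (edges p i) c Fin.≤ lookup (edges p i) d →
          Gen p (toℕ i ℕ.+ toℕ c) (toℕ i ℕ.+ toℕ d)

Q≤ : ∀ {n ℓ} {H : Subgraph n} → Path H ℓ → ℕ → ℕ → Set
Q≤ p = Star (Gen p)

record Loop {n} (H : Subgraph n) (v : Vert n) : Set where
  field
    len-1 : ℕ
    path : Path H (suc len-1)
    start≡ : start path ≡ v
    end≡ : end path ≡ v
open Loop public

data Sign : Set where
  plus minus : Sign

-- Drift_γ(j) = ε  (ℓ = length of γ; indices 0-based, so x_j ↦ j and x_{ℓ+j} ↦ ℓ+j)
DriftIs : ∀ {n} {H : Subgraph n} {v} → Loop H v → Fin n → Sign → Set
DriftIs γ j plus = Q≤ (path γ) (toℕ j) (suc (len-1 γ) ℕ.+ toℕ j)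
DriftIs γ j minus = Q≤ (path γ) (suc (len-1 γ) ℕ.+ toℕ j) (toℕ j)
                    × ¬ Q≤ (path γ) (toℕ j) (suc (len-1 γ) ℕ.+ toℕ j)

StronglyConnected : ∀ {n} → Subgraph n → Set
StronglyConnected {n} H =
  (∃[ v ] V H v) ×
  (∀ u w → V H u → V H w → ∃[ ℓ ] Σ (Path H ℓ) (λ p → start p ≡ u × end p ≡ w))

Drifts : ∀ {n} → Subgraph n → Set
Drifts {n} H = ∃[ v ] (V H v × ∃[ j ] ∃[ ε ] (∀ (γ : Loop H v) → DriftIs γ j ε))

Driftless : ∀ {n} → Subgraph n → Set
Driftless H = ¬ Drifts H

-- Suppose H drifts: every loop of H at v has drift ε in coordinate j.  Fix a vertex u of K and call a
-- coordinate c reachable along a walk α from v to u if x_j ≤ x_{|α|+c} in Q_α (≥ when ε = −).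
-- Such a comparison can always be realised by a thread, a chain crossing each window once, because
-- Q_α has a linear extension inducing on each window the order of its vertex (it also makes Q_α
-- antisymmetric, which supplies the strict half of a negative drift).  Under a double negation we
-- find, for every r, a walk α whose reachable coordinates all have depth ≥ r in u, the depth being
-- the rank in u counted from the ε-bottom: if k has depth r, either every loop of K at u threads k
-- to itself, and K drifts at u, or appending a loop that does not pushes everything reachable deeper.
-- For r = n nothing is reachable, yet closing α up through a loop of K at u and a walk back to v
-- gives a loop of H at v, whose drift makes j reachable.

module Submission where

open import Defs
open import Data.Nat using (ℕ; zero; suc; _+_; _*_; _∸_; _≤_; _<_; _⊔_; z≤n; s≤s; _≤?_; _<?_; _≟_; s≤s⁻¹)
open import Data.Nat.Properties
open import Data.Fin as Fin using (Fin; toℕ; inject₁; fromℕ; fromℕ<)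
open import Data.Fin.Properties using (toℕ-injective; toℕ-inject₁; toℕ-fromℕ; toℕ<n; toℕ-fromℕ<; any?)
open import Data.Vec using (Vec; lookup; replicate)
open import Data.Product using (Σ; Σ-syntax; ∃-syntax; _×_; _,_; proj₁; proj₂)
open import Data.Sum using (_⊎_; inj₁; inj₂)
open import Data.Empty using (⊥; ⊥-elim)
open import Function using (id)
open import Function.Bundles using (_⇔_; Equivalence)
open import Relation.Nullary using (¬_; Dec; yes; no)
open import Relation.Nullary.Decidable using (_×-dec_)
open import Relation.Binary.PropositionalEquality
open import Relation.Binary.Construct.Closure.ReflexiveTransitive using (Star; _◅_; _◅◅_; gmap; reverse)
  renaming (ε to ε*)

infix 4 _≤[_]_

_≤[_]_ : ℕ → Sign → ℕ → Set
x ≤[ plus ] y = x ≤ y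
x ≤[ minus ] y = y ≤ x

opposite : Sign → Sign
opposite plus = minus
opposite minus = plus

≤[]-refl : ∀ ε {x} → x ≤[ ε ] x
≤[]-refl plus = ≤-refl
≤[]-refl minus = ≤-refl

≤[]-trans : ∀ ε {x y z} → x ≤[ ε ] y → y ≤[ ε ] z → x ≤[ ε ] z
≤[]-trans plus p q = ≤-trans p q
≤[]-trans minus p q = ≤-trans q p

≤[]-opposite : ∀ ε {x y} → x ≤[ ε ] y → y ≤[ opposite ε ] x
≤[]-opposite plus p = p
≤[]-opposite minus p = p

_≤[_]?_ : ∀ x ε y → Dec (x ≤[ ε ] y)
x ≤[ plus ]? y = x ≤? y
x ≤[ minus ]? y = y ≤? x

≤[]-antisym : ∀ ε {x y} → x ≤[ ε ] y → x ≤[ opposite ε ] y → x ≡ y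
≤[]-antisym plus p q = ≤-antisym p q
≤[]-antisym minus p q = ≤-antisym q p

infixl 10 _!_
_!_ : ∀ {m k} → Vec (Fin m) k → Fin k → ℕ
σ ! c = toℕ (lookup σ c)

Realises : ∀ {m} → Vec (Fin m) m → (Fin m → ℕ) → Set
Realises σ g = ∀ c d → σ ! c < σ ! d → g c < g d

module _ {m} {σ : Vec (Fin m) m} {g : Fin m → ℕ} (realises : Realises σ g) where

  realises-≤ : Injective-lookup σ → ∀ {c d} → σ ! c ≤ σ ! d → g c ≤ g d
  realises-≤ injective {c} {d} σc≤σd with m≤n⇒m<n∨m≡n σc≤σd
  ... | inj₁ σc<σd = <⇒≤ (realises c d σc<σd)
  ... | inj₂ σc≡σd rewrite injective c d (toℕ-injective σc≡σd) = ≤-refl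

  realises-≤[] : Injective-lookup σ → ∀ ε {c d} → σ ! c ≤[ ε ] σ ! d → g c ≤[ ε ] g d
  realises-≤[] injective plus = realises-≤ injective
  realises-≤[] injective minus = realises-≤ injective

  reflects-≤ : ∀ {c d} → g c ≤ g d → σ ! c ≤ σ ! d
  reflects-≤ {c} {d} gc≤gd = ≮⇒≥ (λ σd<σc → <⇒≱ (realises d c σd<σc) gc≤gd)

  reflects-≤[] : ∀ ε {c d} → g c ≤[ ε ] g d → σ ! c ≤[ ε ] σ ! d
  reflects-≤[] plus = reflects-≤
  reflects-≤[] minus = reflects-≤

edgeFromTo-cong : ∀ {n} {e e' : Edge n} {u u' w w'} → e ≡ e' → u ≡ u' → w ≡ w' →
                  EdgeFromTo e u w → EdgeFromTo e' u' w'
edgeFromTo-cong refl refl refl = id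

clamp : ∀ {m} → ℕ → Fin (suc m)
clamp zero = Fin.zero
clamp {zero} (suc x) = Fin.zero
clamp {suc m} (suc x) = Fin.suc (clamp x)

toℕ-clamp : ∀ {m} x → x ≤ m → toℕ (clamp {m} x) ≡ x
toℕ-clamp zero _ = refl
toℕ-clamp {suc m} (suc x) (s≤s x≤m) = cong suc (toℕ-clamp x x≤m)

clamp-toℕ : ∀ {m} (c : Fin (suc m)) → clamp (toℕ c) ≡ c
clamp-toℕ c = toℕ-injective (toℕ-clamp (toℕ c) (s≤s⁻¹ (toℕ<n c)))

clamp-inject₁ : ∀ {m} (c : Fin m) → clamp (toℕ c) ≡ inject₁ c
clamp-inject₁ c = toℕ-injective (trans (toℕ-clamp (toℕ c) (<⇒≤ (toℕ<n c))) (sym (toℕ-inject₁ c)))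

fin-of : ∀ {m} i → i < m → ∃[ x ] toℕ x ≡ i
fin-of i i<m = fromℕ< i<m , toℕ-fromℕ< i<m

-- Walks indexed by ℕ rather than Fin; positions beyond the length carry junk.
record Walk {n} (H : Subgraph n) : Set where
  field
    len : ℕ
    vert : ℕ → Vert n
    edge : ℕ → Edge n
    vert-in : ∀ a → a ≤ len → V H (vert a)
    edge-in : ∀ i → i < len → E H (edge i)
    incident : ∀ i → i < len → EdgeFromTo (edge i) (vert i) (vert (suc i))
open Walk public

module _ {n} {H : Subgraph n} where

  vert-perm : (W : Walk H) → ∀ a → a ≤ len W → IsPerm (vert W a)
  vert-perm W a a≤len = V-perm H (vert W a) (vert-in W a a≤len)

  edge-perm : (W : Walk H) → ∀ i → i < len W → IsPerm (edge W i)
  edge-perm W i i<len = proj₁ (incident W i i<len)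

  source-order : (W : Walk H) → ∀ i → i < len W → ∀ c d →
                 (edge W i ! inject₁ c < edge W i ! inject₁ d) ⇔ (vert W i ! c < vert W i ! d)
  source-order W i i<len = proj₂ (proj₁ (proj₂ (incident W i i<len)))

  target-realises : (W : Walk H) → ∀ i → i < len W → Realises (vert W (suc i)) (λ c → edge W i ! Fin.suc c)
  target-realises W i i<len c d = Equivalence.from (proj₂ (proj₂ (proj₂ (incident W i i<len))) c d)

  mapWalk : ∀ {G} → H ⊆G G → Walk H → Walk G
  mapWalk H⊆G W = record
    { len = len W ; vert = vert W ; edge = edge W
    ; vert-in = λ a a≤len → proj₁ H⊆G _ (vert-in W a a≤len)
    ; edge-in = λ i i<len → proj₂ H⊆G _ (edge-in W i i<len)
    ; incident = incident W }

  Agrees : ∀ {H' : Subgraph n} {ℓ} → Path H' ℓ → Walk H → Set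
  Agrees {ℓ = ℓ} p W =
    len W ≡ ℓ × (∀ a → verts p a ≡ vert W (toℕ a)) × (∀ i → edges p i ≡ edge W (toℕ i))

  pathOf : ∀ {ℓ} (W : Walk H) → len W ≡ ℓ → Path H ℓ
  pathOf W refl = record
    { verts = λ a → vert W (toℕ a)
    ; edges = λ i → edge W (toℕ i)
    ; verts-in = λ a → vert-in W (toℕ a) (s≤s⁻¹ (toℕ<n a))
    ; edges-in = λ i → edge-in W (toℕ i) (toℕ<n i)
    ; incid = λ i → subst (λ k → EdgeFromTo (edge W (toℕ i)) (vert W k) (vert W (suc (toℕ i))))
                          (sym (toℕ-inject₁ i)) (incident W (toℕ i) (toℕ<n i))
    }

  pathOf-agrees : ∀ {ℓ} (W : Walk H) (len≡ : len W ≡ ℓ) → Agrees (pathOf W len≡) W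
  pathOf-agrees W refl = refl , (λ _ → refl) , (λ _ → refl)

  loopOf : ∀ {v m} (Λ : Walk H) → len Λ ≡ suc m → vert Λ 0 ≡ v → vert Λ (len Λ) ≡ v → Loop H v
  loopOf {m = m} Λ len≡ start≡ end≡ = record
    { len-1 = m
    ; path = pathOf Λ len≡
    ; start≡ = trans (verts≡ Fin.zero) start≡
    ; end≡ = trans (verts≡ (fromℕ (suc m))) (trans (cong (vert Λ) (trans (toℕ-fromℕ _) (sym len≡))) end≡)
    }
    where verts≡ = proj₁ (proj₂ (pathOf-agrees Λ len≡))

  edgeAt : ∀ {ℓ} → (Fin ℓ → Edge n) → ℕ → Edge n
  edgeAt {zero} _ _ = replicate _ Fin.zero
  edgeAt {suc ℓ} es i = es (clamp i)

  edgeAt-toℕ : ∀ {ℓ} (es : Fin ℓ → Edge n) i → edgeAt es (toℕ i) ≡ es i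
  edgeAt-toℕ {suc ℓ} es i = cong es (clamp-toℕ i)

  walkOf : ∀ {ℓ} → Path H ℓ → Walk H
  walkOf {ℓ} p = record
    { len = ℓ
    ; vert = λ a → verts p (clamp a)
    ; edge = edgeAt (edges p)
    ; vert-in = λ a _ → verts-in p (clamp a)
    ; edge-in = λ i i<ℓ → edge-in′ i (fin-of i i<ℓ)
    ; incident = λ i i<ℓ → incident′ i (fin-of i i<ℓ)
    }
    where
      edge-in′ : ∀ i → ∃[ x ] toℕ x ≡ i → E H (edgeAt (edges p) i)
      edge-in′ _ (x , refl) = subst (E H) (sym (edgeAt-toℕ (edges p) x)) (edges-in p x)

      incident′ : ∀ i → ∃[ x ] toℕ x ≡ i →
                  EdgeFromTo (edgeAt (edges p) i) (verts p (clamp i)) (verts p (clamp (suc i)))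
      incident′ _ (x , refl) =
        edgeFromTo-cong (sym (edgeAt-toℕ (edges p) x)) (cong (verts p) (sym (clamp-inject₁ x)))
          (cong (verts p) (sym (clamp-toℕ (Fin.suc x)))) (incid p x)

  walkOf-agrees : ∀ {ℓ} (p : Path H ℓ) → Agrees p (walkOf p)
  walkOf-agrees p = refl , (λ a → cong (verts p) (sym (clamp-toℕ a))) , (λ i → sym (edgeAt-toℕ (edges p) i))

  walkOf-end : ∀ {ℓ} (p : Path H ℓ) → vert (walkOf p) ℓ ≡ end p
  walkOf-end {ℓ} p = cong (verts p) (toℕ-injective (trans (toℕ-clamp ℓ ≤-refl) (sym (toℕ-fromℕ ℓ))))

module Append {n} {H : Subgraph n} (α β : Walk H) (join : vert α (len α) ≡ vert β 0) where

  private
    a = len α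

  vert′ : ℕ → Vert n
  vert′ i with i ≤? a
  ... | yes _ = vert α i
  ... | no _ = vert β (i ∸ a)

  edge′ : ℕ → Edge n
  edge′ i with i <? a
  ... | yes _ = edge α i
  ... | no _ = edge β (i ∸ a)

  vertˡ : ∀ i → i ≤ a → vert′ i ≡ vert α i
  vertˡ i i≤a with i ≤? a
  ... | yes _ = refl
  ... | no i≰a = ⊥-elim (i≰a i≤a)

  vertʳ : ∀ k → vert′ (a + k) ≡ vert β k
  vertʳ zero with a + 0 ≤? a
  ... | yes _ = trans (cong (vert α) (+-identityʳ a)) join
  ... | no a+0≰a = ⊥-elim (a+0≰a (≤-reflexive (+-identityʳ a)))
  vertʳ (suc k) with a + suc k ≤? a
  ... | yes a+1+k≤a = ⊥-elim (m+n≮m a k (subst (_≤ a) (+-suc a k) a+1+k≤a))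
  ... | no _ = cong (vert β) (m+n∸m≡n a (suc k))

  edgeˡ : ∀ i → i < a → edge′ i ≡ edge α i
  edgeˡ i i<a with i <? a
  ... | yes _ = refl
  ... | no i≮a = ⊥-elim (i≮a i<a)

  edgeʳ : ∀ k → edge′ (a + k) ≡ edge β k
  edgeʳ k with a + k <? a
  ... | yes a+k<a = ⊥-elim (m+n≮m a k a+k<a)
  ... | no _ = cong (edge β) (m+n∸m≡n a k)

  data Side (i : ℕ) : Set where
    left : i < a → Side i
    right : ∀ k → i ≡ a + k → Side i

  side : ∀ i → Side i
  side i with i <? a
  ... | yes i<a = left i<a
  ... | no i≮a = right (i ∸ a) (sym (m+[n∸m]≡n (≮⇒≥ i≮a)))

  walk : Walk H
  walk = record
    { len = a + len β ; vert = vert′ ; edge = edge′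
    ; vert-in = vert-in′ ; edge-in = edge-in′ ; incident = incident′ }
    where
      vert-in′ : ∀ i → i ≤ a + len β → V H (vert′ i)
      vert-in′ i i≤ with i ≤? a
      ... | yes i≤a = vert-in α i i≤a
      ... | no i≰a = vert-in β (i ∸ a) (+-cancelˡ-≤ a _ _
                       (subst (_≤ a + len β) (sym (m+[n∸m]≡n (<⇒≤ (≰⇒> i≰a)))) i≤))

      edge-in′ : ∀ i → i < a + len β → E H (edge′ i)
      edge-in′ i i< with side i
      ... | left i<a = subst (E H) (sym (edgeˡ i i<a)) (edge-in α i i<a)
      ... | right k refl = subst (E H) (sym (edgeʳ k)) (edge-in β k (+-cancelˡ-< a k _ i<))

      incident′ : ∀ i → i < a + len β → EdgeFromTo (edge′ i) (vert′ i) (vert′ (suc i))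
      incident′ i i< with side i
      ... | left i<a = edgeFromTo-cong (sym (edgeˡ i i<a)) (sym (vertˡ i (<⇒≤ i<a))) (sym (vertˡ (suc i) i<a))
                         (incident α i i<a)
      ... | right k refl =
        edgeFromTo-cong (sym (edgeʳ k)) (sym (vertʳ k)) (sym (trans (cong vert′ (sym (+-suc a k))) (vertʳ (suc k))))
          (incident β k (+-cancelˡ-< a k _ i<))

data GenW {n} {H : Subgraph n} (ε : Sign) (W : Walk H) (lo hi : ℕ) : ℕ → ℕ → Set where
  vertex-gen : ∀ a (c d : Fin n) → lo ≤ a → a ≤ hi → vert W a ! c ≤[ ε ] vert W a ! d →
               GenW ε W lo hi (a + toℕ c) (a + toℕ d)
  edge-gen : ∀ i (c d : Fin (suc n)) → lo ≤ i → i < hi → edge W i ! c ≤[ ε ] edge W i ! d →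
             GenW ε W lo hi (i + toℕ c) (i + toℕ d)

Chain : ∀ {n} {H : Subgraph n} → Sign → Walk H → ℕ → ℕ → ℕ → ℕ → Set
Chain ε W lo hi = Star (GenW ε W lo hi)

module _ {n} {H : Subgraph n} {W : Walk H} where

  genW-reverse : ∀ ε {lo hi x z} → GenW ε W lo hi x z → GenW (opposite ε) W lo hi z x
  genW-reverse ε (vertex-gen a c d lo≤a a≤hi le) = vertex-gen a d c lo≤a a≤hi (≤[]-opposite ε le)
  genW-reverse ε (edge-gen i c d lo≤i i<hi le) = edge-gen i d c lo≤i i<hi (≤[]-opposite ε le)

  chain-reverse : ∀ ε {lo hi x z} → Chain ε W lo hi x z → Chain (opposite ε) W lo hi z x
  chain-reverse ε = reverse (genW-reverse ε)

module _ {n} {H' H : Subgraph n} {ℓ} {p : Path H' ℓ} {W : Walk H} (agree : Agrees p W) where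

  private
    verts≡ = proj₁ (proj₂ agree)
    edges≡ = proj₂ (proj₂ agree)

  gen⇒genW : ∀ {x z} → Gen p x z → GenW plus W 0 ℓ x z
  gen⇒genW (gen-v a c d le) =
    vertex-gen (toℕ a) c d z≤n (s≤s⁻¹ (toℕ<n a)) (subst (λ σ → σ ! c ≤ σ ! d) (verts≡ a) le)
  gen⇒genW (gen-e i c d le) =
    edge-gen (toℕ i) c d z≤n (toℕ<n i) (subst (λ σ → σ ! c ≤ σ ! d) (edges≡ i) le)

  genW⇒gen : ∀ {x z} → GenW plus W 0 ℓ x z → Gen p x z
  genW⇒gen (vertex-gen a c d _ a≤ℓ le) with fin-of a (s≤s a≤ℓ)
  ... | x , refl = gen-v x c d (subst (λ σ → σ ! c ≤ σ ! d) (sym (verts≡ x)) le)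
  genW⇒gen (edge-gen i c d _ i<ℓ le) with fin-of i i<ℓ
  ... | x , refl = gen-e x c d (subst (λ σ → σ ! c ≤ σ ! d) (sym (edges≡ x)) le)

  Q≤⇒chain : ∀ {x z} → Q≤ p x z → Chain plus W 0 ℓ x z
  Q≤⇒chain = gmap id gen⇒genW

  chain⇒Q≤ : ∀ {x z} → Chain plus W 0 ℓ x z → Q≤ p x z
  chain⇒Q≤ = gmap id genW⇒gen

-- Thread ε W i c d: a chain x_c ≤ x_{w₀} ≤ x_{1+w₁} ≤ … ≤ x_{i+d} that crosses each window once.
Thread : ∀ {n} {H : Subgraph n} → Sign → Walk H → ℕ → Fin n → Fin n → Set
Thread ε W zero c d = vert W 0 ! c ≤[ ε ] vert W 0 ! d
Thread {n} ε W (suc i) c d = ∃[ w ] Thread ε W i c w × edge W i ! inject₁ w ≤[ ε ] edge W i ! Fin.suc d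

module _ {n} {H : Subgraph n} where

  thread? : ∀ ε (W : Walk H) i c d → Dec (Thread ε W i c d)
  thread? ε W zero c d = _ ≤[ ε ]? _
  thread? ε W (suc i) c d = any? (λ w → thread? ε W i c w ×-dec _ ≤[ ε ]? _)

  thread-cong : ∀ {H'} {W : Walk H} {W' : Walk H'} {ε i c d} → vert W 0 ≡ vert W' 0 →
                (∀ k → k < i → edge W k ≡ edge W' k) → Thread ε W i c d → Thread ε W' i c d
  thread-cong {ε = ε} {zero} {c} {d} vert≡ _ t = subst (λ σ → σ ! c ≤[ ε ] σ ! d) vert≡ t
  thread-cong {ε = ε} {suc i} {d = d} vert≡ edge≡ (w , t , le) =
    w , thread-cong vert≡ (λ k k<i → edge≡ k (m<n⇒m<1+n k<i)) t ,
    subst (λ σ → σ ! inject₁ w ≤[ ε ] σ ! Fin.suc d) (edge≡ i ≤-refl) le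

  thread⇒chain : ∀ {ε} {W : Walk H} {hi} i {c d} → i ≤ hi → Thread ε W i c d →
                 Chain ε W 0 hi (toℕ c) (i + toℕ d)
  thread⇒chain zero {c} {d} _ t = vertex-gen 0 c d z≤n z≤n t ◅ ε*
  thread⇒chain (suc i) {c} {d} i<hi (w , t , le) =
    thread⇒chain i (<⇒≤ i<hi) t ◅◅
    (subst₂ (GenW _ _ 0 _) (cong (i +_) (toℕ-inject₁ w)) (+-suc i (toℕ d))
       (edge-gen i (inject₁ w) (Fin.suc d) z≤n i<hi le) ◅ ε*)

  thread-extendˡ : ∀ ε {W : Walk H} i {c c' d} → vert W 0 ! c' ≤[ ε ] vert W 0 ! c →
                   Thread ε W i c d → Thread ε W i c' d
  thread-extendˡ ε zero le t = ≤[]-trans ε le t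
  thread-extendˡ ε (suc i) le (w , t , e) = w , thread-extendˡ ε i le t , e

  thread-extendʳ : ∀ ε (W : Walk H) i {c d d'} → i ≤ len W →
                   Thread ε W i c d → vert W i ! d ≤[ ε ] vert W i ! d' → Thread ε W i c d'
  thread-extendʳ ε W zero _ t le = ≤[]-trans ε t le
  thread-extendʳ ε W (suc i) i<len (w , t , e) le =
    w , t , ≤[]-trans ε e (realises-≤[] {σ = vert W (suc i)} (target-realises W i i<len) (vert-perm W (suc i) i<len) ε le)

maxᶠ : ∀ {m} → (Fin m → ℕ) → ℕ
maxᶠ {zero} g = 0
maxᶠ {suc m} g = g Fin.zero ⊔ maxᶠ (λ c → g (Fin.suc c))

≤-maxᶠ : ∀ {m} (g : Fin m → ℕ) c → g c ≤ maxᶠ g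
≤-maxᶠ g Fin.zero = m≤m⊔n _ _
≤-maxᶠ g (Fin.suc c) = ≤-trans (≤-maxᶠ (λ c → g (Fin.suc c)) c) (m≤n⊔m _ _)

maxᶠ-lub : ∀ {m} (g : Fin m → ℕ) {b} → (∀ c → g c ≤ b) → maxᶠ g ≤ b
maxᶠ-lub {zero} g _ = z≤n
maxᶠ-lub {suc m} g g≤b = ⊔-lub (g≤b Fin.zero) (maxᶠ-lub (λ c → g (Fin.suc c)) (λ c → g≤b (Fin.suc c)))

data InjectOrLast {n} : Fin (suc n) → Set where
  inject : (c : Fin n) → InjectOrLast (inject₁ c)
  last : InjectOrLast (fromℕ n)

injectOrLast : ∀ {n} (c : Fin (suc n)) → InjectOrLast c
injectOrLast {zero} Fin.zero = last
injectOrLast {suc n} Fin.zero = inject Fin.zero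
injectOrLast {suc n} (Fin.suc c) with injectOrLast c
... | inject c' = inject (Fin.suc c')
... | last = last

-- A linear extension y of Q_W: an injective ℕ-labelling of the positions that realises the order of
-- every vertex and edge on its window.  It is built edge by edge; inserting the position i + n
-- doubles the old labels and puts the new one at an odd value just above everything that edge i
-- places below it.
module LinearExtension {n} {H : Subgraph n} (W : Walk H) (len>0 : 0 < len W) where

  private
    ℓ = len W

  record Placed (i : ℕ) (y : ℕ → ℕ) : Set where
    field
      vertex-order : Realises (vert W i) (λ c → y (i + toℕ c))
      edge-order : ∀ k → k < i → Realises (edge W k) (λ c → y (k + toℕ c))
      injective : ∀ x x' → x < i + n → x' < i + n → y x ≡ y x' → x ≡ x'
  open Placed

  below-last : ℕ → (ℕ → ℕ) → Fin n → ℕ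
  below-last i y c with edge W i ! inject₁ c <? edge W i ! fromℕ n
  ... | yes _ = suc (y (i + toℕ c))
  ... | no _ = 0

  insert : ℕ → (ℕ → ℕ) → ℕ → ℕ
  insert i y x with x <? i + n
  ... | yes _ = 2 * suc (y x)
  ... | no _ = suc (2 * maxᶠ (below-last i y))

  insert-old : ∀ i y x → x < i + n → insert i y x ≡ 2 * suc (y x)
  insert-old i y x x< with x <? i + n
  ... | yes _ = refl
  ... | no x≮ = ⊥-elim (x≮ x<)

  insert-new : ∀ i y → insert i y (i + n) ≡ suc (2 * maxᶠ (below-last i y))
  insert-new i y with i + n <? i + n
  ... | yes i+n<i+n = ⊥-elim (<-irrefl refl i+n<i+n)
  ... | no _ = refl

  stage : ℕ → ℕ → ℕ
  stage zero x = edge W 0 ! clamp x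
  stage (suc i) = insert i (stage i)

  placed-zero : Placed 0 (stage 0)
  placed-zero .vertex-order c d lt rewrite clamp-inject₁ c | clamp-inject₁ d =
    Equivalence.from (source-order W 0 len>0 c d) lt
  placed-zero .edge-order _ ()
  placed-zero .injective x x' x<n x'<n eq =
    trans (sym (toℕ-clamp x (<⇒≤ x<n)))
      (trans (cong toℕ (edge-perm W 0 len>0 (clamp x) (clamp x') (toℕ-injective eq)))
             (toℕ-clamp x' (<⇒≤ x'<n)))

  module Insert (i : ℕ) (i<ℓ : i < ℓ) {y : ℕ → ℕ} (P : Placed i y) where

    private
      lo = maxᶠ (below-last i y)
      y′ = insert i y

    old : ∀ (c : Fin n) → y′ (i + toℕ c) ≡ 2 * suc (y (i + toℕ c))
    old c = insert-old i y _ (+-monoʳ-< i (toℕ<n c))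

    below-lo : ∀ c → edge W i ! inject₁ c < edge W i ! fromℕ n → suc (y (i + toℕ c)) ≤ lo
    below-lo c c<last with edge W i ! inject₁ c <? edge W i ! fromℕ n | ≤-maxᶠ (below-last i y) c
    ... | yes _ | le = le
    ... | no c≮last | _ = ⊥-elim (c≮last c<last)

    lo-below : ∀ d → edge W i ! fromℕ n < edge W i ! inject₁ d → lo ≤ y (i + toℕ d)
    lo-below d last<d = maxᶠ-lub (below-last i y) bound
      where
        bound : ∀ c → below-last i y c ≤ y (i + toℕ d)
        bound c with edge W i ! inject₁ c <? edge W i ! fromℕ n
        ... | yes c<last = vertex-order P c d (Equivalence.to (source-order W i i<ℓ c d) (<-trans c<last last<d))
        ... | no _ = z≤n

    new-edge-order : Realises (edge W i) (λ c → y′ (i + toℕ c))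
    new-edge-order c d lt with injectOrLast c | injectOrLast d
    ... | inject c′ | inject d′ rewrite toℕ-inject₁ c′ | toℕ-inject₁ d′ | old c′ | old d′ =
      *-monoʳ-< 2 (s≤s (vertex-order P c′ d′ (Equivalence.to (source-order W i i<ℓ c′ d′) lt)))
    ... | inject c′ | last rewrite toℕ-inject₁ c′ | toℕ-fromℕ n | old c′ | insert-new i y =
      s≤s (*-monoʳ-≤ 2 (below-lo c′ lt))
    ... | last | inject d′ rewrite toℕ-inject₁ d′ | toℕ-fromℕ n | old d′ | insert-new i y =
      subst (_≤ 2 * suc (y (i + toℕ d′))) (*-suc 2 lo) (*-monoʳ-≤ 2 (s≤s (lo-below d′ lt)))
    ... | last | last = ⊥-elim (<-irrefl refl lt)

    placed-suc : Placed (suc i) y′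
    placed-suc .vertex-order c d lt =
      subst₂ (λ a b → y′ a < y′ b) (+-suc i (toℕ c)) (+-suc i (toℕ d))
        (new-edge-order (Fin.suc c) (Fin.suc d) (target-realises W i i<ℓ c d lt))
    placed-suc .edge-order k k<1+i c d lt with m≤n⇒m<n∨m≡n (s≤s⁻¹ k<1+i)
    ... | inj₂ refl = new-edge-order c d lt
    ... | inj₁ k<i =
      subst₂ _<_ (sym (insert-old i y _ (inside c))) (sym (insert-old i y _ (inside d)))
        (*-monoʳ-< 2 (s≤s (edge-order P k k<i c d lt)))
      where
        inside : ∀ (c : Fin (suc n)) → k + toℕ c < i + n
        inside c = ≤-<-trans (+-monoʳ-≤ k (s≤s⁻¹ (toℕ<n c))) (+-monoˡ-< n k<i)
    placed-suc .injective x x' x< x'< eq with m≤n⇒m<n∨m≡n (s≤s⁻¹ x<) | m≤n⇒m<n∨m≡n (s≤s⁻¹ x'<)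
    ... | inj₁ x<i+n | inj₁ x'<i+n =
      injective P x x' x<i+n x'<i+n
        (suc-injective (*-cancelˡ-≡ _ _ 2 (trans (sym (insert-old i y x x<i+n))
                                                  (trans eq (insert-old i y x' x'<i+n)))))
    ... | inj₁ x<i+n | inj₂ refl =
      ⊥-elim (even≢odd (suc (y x)) lo (trans (sym (insert-old i y x x<i+n)) (trans eq (insert-new i y))))
    ... | inj₂ refl | inj₁ x'<i+n =
      ⊥-elim (even≢odd (suc (y x')) lo (trans (sym (insert-old i y x' x'<i+n)) (trans (sym eq) (insert-new i y))))
    ... | inj₂ refl | inj₂ refl = refl

  placed : ∀ i → i ≤ ℓ → Placed i (stage i)
  placed zero _ = placed-zero
  placed (suc i) i<ℓ = Insert.placed-suc i i<ℓ (placed i (<⇒≤ i<ℓ))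

  y : ℕ → ℕ
  y = stage ℓ

  edge-realised : ∀ i → i < ℓ → Realises (edge W i) (λ c → y (i + toℕ c))
  edge-realised = edge-order (placed ℓ ≤-refl)

  vertex-realised : ∀ a → a ≤ ℓ → Realises (vert W a) (λ c → y (a + toℕ c))
  vertex-realised a a≤ℓ c d lt with m≤n⇒m<n∨m≡n a≤ℓ
  ... | inj₂ refl = vertex-order (placed ℓ ≤-refl) c d lt
  ... | inj₁ a<ℓ = subst₂ (λ u w → y (a + u) < y (a + w)) (toℕ-inject₁ c) (toℕ-inject₁ d)
                     (edge-realised a a<ℓ (inject₁ c) (inject₁ d) (Equivalence.from (source-order W a a<ℓ c d) lt))

  y-injective : ∀ x x' → x < ℓ + n → x' < ℓ + n → y x ≡ y x' → x ≡ x'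
  y-injective = injective (placed ℓ ≤-refl)

  genW-monotone : ∀ ε {lo hi x z} → hi ≤ ℓ → GenW ε W lo hi x z → y x ≤[ ε ] y z
  genW-monotone ε hi≤ℓ (vertex-gen a c d _ a≤hi le) =
    realises-≤[] {σ = vert W a} (vertex-realised a (≤-trans a≤hi hi≤ℓ)) (vert-perm W a (≤-trans a≤hi hi≤ℓ)) ε le
  genW-monotone ε hi≤ℓ (edge-gen i c d _ i<hi le) =
    realises-≤[] {σ = edge W i} (edge-realised i (<-≤-trans i<hi hi≤ℓ)) (edge-perm W i (<-≤-trans i<hi hi≤ℓ)) ε le

  chain-monotone : ∀ ε {lo hi x z} → hi ≤ ℓ → Chain ε W lo hi x z → y x ≤[ ε ] y z
  chain-monotone ε hi≤ℓ ε* = ≤[]-refl ε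
  chain-monotone ε hi≤ℓ (g ◅ gs) = ≤[]-trans ε (genW-monotone ε hi≤ℓ g) (chain-monotone ε hi≤ℓ gs)

  vertex-reflects : ∀ ε a → a ≤ ℓ → ∀ {c d} → y (a + toℕ c) ≤[ ε ] y (a + toℕ d) →
                    vert W a ! c ≤[ ε ] vert W a ! d
  vertex-reflects ε a a≤ℓ = reflects-≤[] {σ = vert W a} (vertex-realised a a≤ℓ) ε

  edge-reflects : ∀ ε i → i < ℓ → ∀ {c d} → y (i + toℕ c) ≤[ ε ] y (i + toℕ d) →
                  edge W i ! c ≤[ ε ] edge W i ! d
  edge-reflects ε i i<ℓ = reflects-≤[] {σ = edge W i} (edge-realised i i<ℓ) ε

  chain-antisym : ∀ ε {lo hi x z} → hi ≤ ℓ → x < ℓ + n → z < ℓ + n →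
                  Chain ε W lo hi x z → Chain (opposite ε) W lo hi x z → x ≡ z
  chain-antisym ε hi≤ℓ x< z< xz zx =
    y-injective _ _ x< z< (≤[]-antisym ε (chain-monotone ε hi≤ℓ xz) (chain-monotone (opposite ε) hi≤ℓ zx))

  -- A chain from window m's left to its right can be rerouted to cross window m just once: a right
  -- excursion returning into window m compares two positions of that window, so by the linear extension
  -- it can be replaced by a single generator of vertex m.
  module Cut (ε : Sign) {lo m hi} (lo≤m : lo ≤ m) (m≤hi : m ≤ hi) (hi≤ℓ : hi ≤ ℓ) where

    Left = GenW ε W lo m
    Right = GenW ε W m hi

    classify : ∀ {x z} → GenW ε W lo hi x z →
               (Left x z × x < m + n × z < m + n) ⊎ (Right x z × m ≤ x × m ≤ z)
    classify (vertex-gen a c d lo≤a a≤hi le) with a ≤? m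
    ... | yes a≤m = inj₁ (vertex-gen a c d lo≤a a≤m le , +-mono-≤-< a≤m (toℕ<n c) , +-mono-≤-< a≤m (toℕ<n d))
    ... | no a≰m = let m≤a = <⇒≤ (≰⇒> a≰m) in
      inj₂ (vertex-gen a c d m≤a a≤hi le , ≤-trans m≤a (m≤m+n a _) , ≤-trans m≤a (m≤m+n a _))
    classify (edge-gen i c d lo≤i i<hi le) with i <? m
    ... | yes i<m =
      inj₁ (edge-gen i c d lo≤i i<m le , +-mono-<-≤ i<m (s≤s⁻¹ (toℕ<n c)) , +-mono-<-≤ i<m (s≤s⁻¹ (toℕ<n d)))
    ... | no i≮m = let m≤i = ≮⇒≥ i≮m in
      inj₂ (edge-gen i c d m≤i i<hi le , ≤-trans m≤i (m≤m+n i _) , ≤-trans m≤i (m≤m+n i _))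

    in-window : ∀ {z} → m ≤ z → z < m + n → Σ[ w ∈ Fin n ] z ≡ m + toℕ w
    in-window {z} m≤z z<m+n = fromℕ< z∸m<n , trans (sym m+[z∸m]≡z) (cong (m +_) (sym (toℕ-fromℕ< z∸m<n)))
      where
        m+[z∸m]≡z = m+[n∸m]≡n m≤z
        z∸m<n = +-cancelˡ-< m (z ∸ m) n (subst (_< m + n) (sym m+[z∸m]≡z) z<m+n)

    right-stays-right : ∀ {x z} → Star Right x z → m ≤ x → m ≤ z
    right-stays-right ε* m≤x = m≤x
    right-stays-right (vertex-gen a _ _ m≤a _ _ ◅ gs) _ = right-stays-right gs (≤-trans m≤a (m≤m+n a _))
    right-stays-right (edge-gen i _ _ m≤i _ _ ◅ gs) _ = right-stays-right gs (≤-trans m≤i (m≤m+n i _))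

    Progress : ℕ → ℕ → Set
    Progress s z = (z < m + n × Star Left s z) ⊎ (Σ[ w ∈ Fin n ] Star Left s (m + toℕ w) × Star Right (m + toℕ w) z)

    progress-step : ∀ {s z z'} → Progress s z → GenW ε W lo hi z z' → Progress s z'
    progress-step (inj₁ (z<m+n , left)) g with classify g
    ... | inj₁ (g′ , _ , z'<m+n) = inj₁ (z'<m+n , left ◅◅ (g′ ◅ ε*))
    ... | inj₂ (g′ , m≤z , _) with in-window m≤z z<m+n
    ...   | w , refl = inj₂ (w , left , g′ ◅ ε*)
    progress-step (inj₂ (w , left , right)) g with classify g
    ... | inj₂ (g′ , _) = inj₂ (w , left , right ◅◅ (g′ ◅ ε*))
    ... | inj₁ (g′ , z<m+n , z'<m+n) with in-window (right-stays-right right (m≤m+n m _)) z<m+n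
    ...   | w′ , refl =
      let w≤w′ = vertex-reflects ε m (≤-trans m≤hi hi≤ℓ) (chain-monotone ε hi≤ℓ right)
      in inj₁ (z'<m+n , left ◅◅ (vertex-gen m w w′ lo≤m ≤-refl w≤w′ ◅ g′ ◅ ε*))

    progress : ∀ {s z t} → Progress s z → Chain ε W lo hi z t → Progress s t
    progress p ε* = p
    progress p (g ◅ gs) = progress (progress-step p g) gs

    cut : ∀ {s t} → s < m + n → m ≤ t → Chain ε W lo hi s t →
          Σ[ w ∈ Fin n ] Star Left s (m + toℕ w) × Star Right (m + toℕ w) t
    cut s<m+n m≤t chain with progress (inj₁ (s<m+n , ε*)) chain
    ... | inj₂ crossing = crossing
    ... | inj₁ (t<m+n , left) with in-window m≤t t<m+n
    ...   | w , refl = w , left , ε*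

  chain⇒thread : ∀ ε i → i ≤ ℓ → ∀ {c d} → Chain ε W 0 i (toℕ c) (i + toℕ d) → Thread ε W i c d
  chain⇒thread ε zero _ chain = vertex-reflects ε 0 z≤n (chain-monotone ε z≤n chain)
  chain⇒thread ε (suc i) i<ℓ {c} {d} chain = w , chain⇒thread ε i (<⇒≤ i<ℓ) left , edge-reflects ε i i<ℓ last-step
    where
      open Cut ε z≤n (n≤1+n i) i<ℓ
      crossing = cut (<-≤-trans (toℕ<n c) (m≤n+m n i)) (≤-trans (n≤1+n i) (m≤m+n _ _)) chain
      w = proj₁ crossing
      left = proj₁ (proj₂ crossing)
      last-step : y (i + toℕ (inject₁ w)) ≤[ ε ] y (i + toℕ (Fin.suc d))
      last-step = subst₂ (λ a b → y a ≤[ ε ] y b) (cong (i +_) (sym (toℕ-inject₁ w))) (sym (+-suc i (toℕ d)))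
                    (chain-monotone ε i<ℓ (proj₂ (proj₂ crossing)))

module _ {n} {H : Subgraph n} (α β : Walk H) (join : vert α (len α) ≡ vert β 0) where
  open Append α β join

  thread-split : ∀ ε i {c d} → Thread ε walk (len α + i) c d →
                 Σ[ w ∈ Fin n ] Thread ε α (len α) c w × Thread ε β i w d
  thread-split ε zero {c} {d} t =
    d , thread-cong {W = walk} (vertˡ 0 z≤n) (λ k k<a → edgeˡ k k<a)
          (subst (λ k → Thread ε walk k c d) (+-identityʳ (len α)) t) ,
    ≤[]-refl ε
  thread-split ε (suc i) {c} {d} t with subst (λ k → Thread ε walk k c d) (+-suc (len α) i) t
  ... | w′ , t′ , crossing with thread-split ε i t′
  ...   | w , tα , tβ = w , tα , (w′ , tβ , subst (λ σ → σ ! inject₁ w′ ≤[ ε ] σ ! Fin.suc d) (edgeʳ i) crossing)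

module _ {n} {H' H : Subgraph n} {v} (γ : Loop H' v) {W : Walk H} (agree : Agrees (path γ) W) where

  private
    ℓ = suc (len-1 γ)
    len≡ = proj₁ agree
    open LinearExtension W (subst (0 <_) (sym len≡) (s≤s z≤n))

  drift⇒thread : ∀ ε {j} → DriftIs γ j ε → Thread ε W ℓ j j
  drift⇒thread plus fwd = chain⇒thread plus ℓ (≤-reflexive (sym len≡)) (Q≤⇒chain agree fwd)
  drift⇒thread minus (back , _) =
    chain⇒thread minus ℓ (≤-reflexive (sym len≡)) (chain-reverse plus (Q≤⇒chain agree back))

  thread⇒drift : ∀ ε {k} → Thread ε W ℓ k k → DriftIs γ k ε
  thread⇒drift plus t = chain⇒Q≤ agree (thread⇒chain ℓ ≤-refl t)
  thread⇒drift minus {k} t = chain⇒Q≤ agree (chain-reverse minus backward) , no-forward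
    where
      backward = thread⇒chain ℓ ≤-refl t
      inside : ∀ x → x ≤ ℓ → x + toℕ k < len W + n
      inside x x≤ℓ = subst (λ L → x + toℕ k < L + n) (sym len≡) (+-mono-≤-< x≤ℓ (toℕ<n k))
      no-forward : ¬ Q≤ (path γ) (toℕ k) (ℓ + toℕ k)
      no-forward fwd = m≢1+n+m (toℕ k)
        (chain-antisym plus (≤-reflexive (sym len≡)) (inside 0 z≤n) (inside ℓ ≤-refl) (Q≤⇒chain agree fwd) backward)

depth : ℕ → Sign → ℕ → ℕ
depth n plus x = x
depth n minus x = n ∸ suc x

depth<n : ∀ {n} ε {x} → x < n → depth n ε x < n
depth<n plus x<n = x<n
depth<n minus x<n = ∸-monoʳ-< (s≤s z≤n) x<n

depth-reflects : ∀ {n} ε {x y} → x < n → y < n → depth n ε x ≤ depth n ε y → x ≤[ ε ] y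
depth-reflects plus _ _ le = le
depth-reflects minus _ y<n le = ≮⇒≥ (λ x<y → <⇒≱ (∸-monoʳ-< (s≤s x<y) y<n) le)

module DriftTransfer {n} {K H : Subgraph n} (K⊆H : K ⊆G H)
  (connected : ∀ u w → V H u → V H w → ∃[ ℓ ] Σ (Path H ℓ) (λ p → start p ≡ u × end p ≡ w))
  (K-driftless : Driftless K)
  {v} (v∈H : V H v) (j : Fin n) (ε : Sign) (H-drifts : ∀ (γ : Loop H v) → DriftIs γ j ε)
  {u} (u∈K : V K u) where

  walk-between : ∀ x z → V H x → V H z → Σ[ W ∈ Walk H ] vert W 0 ≡ x × vert W (len W) ≡ z
  walk-between x z x∈H z∈H with connected x z x∈H z∈H
  ... | _ , p , start≡ , end≡ = walkOf p , start≡ , trans (walkOf-end p) end≡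

  loopWalk : Loop K u → Walk H
  loopWalk γ = mapWalk K⊆H (walkOf (path γ))

  loopWalk-end : (γ : Loop K u) → vert (loopWalk γ) (suc (len-1 γ)) ≡ u
  loopWalk-end γ = trans (walkOf-end (path γ)) (end≡ γ)

  rank<n : ∀ c → u ! c < n
  rank<n c = toℕ<n (lookup u c)

  Confined : ℕ → Set
  Confined r = Σ[ α ∈ Walk H ] vert α 0 ≡ v × vert α (len α) ≡ u ×
               (∀ c → Thread ε α (len α) j c → r ≤ depth n ε (u ! c))

  confined-zero : Confined 0
  confined-zero with walk-between v u v∈H (proj₁ K⊆H u u∈K)
  ... | α , start≡ , end≡ = α , start≡ , end≡ , λ _ _ → z≤n

  -- If some loop γ at u does not thread k to itself, where k is the coordinate of depth r, then no
  -- thread along α·γ can end at depth ≤ r: it would pass through depth ≥ r at u and could be closed up.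
  confined-append : ∀ {r} → Confined r → ∀ {k} → depth n ε (u ! k) ≡ r → (γ : Loop K u) →
                    ¬ Thread ε (loopWalk γ) (suc (len-1 γ)) k k → Confined (suc r)
  confined-append {r} (α , α-start , α-end , confined) {k} depth-k γ ¬thread =
    walk , trans (vertˡ 0 z≤n) α-start , trans (vertʳ ℓ) (loopWalk-end γ) , confined′
    where
      G = loopWalk γ
      ℓ = suc (len-1 γ)
      join = trans α-end (sym (start≡ γ))
      open Append α G join

      confined′ : ∀ c → Thread ε walk (len walk) j c → suc r ≤ depth n ε (u ! c)
      confined′ c t with thread-split α G join ε ℓ t
      ... | w , tα , tG with suc r ≤? depth n ε (u ! c)
      ...   | yes deep = deep
      ...   | no ¬deep = ⊥-elim (¬thread (thread-extendʳ ε G ℓ ≤-refl (thread-extendˡ ε ℓ k≤w tG) c≤k))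
        where
          k≤w = subst (λ σ → σ ! k ≤[ ε ] σ ! w) (sym (start≡ γ))
                  (depth-reflects ε (rank<n k) (rank<n w) (subst (_≤ depth n ε (u ! w)) (sym depth-k) (confined w tα)))
          c≤k = subst (λ σ → σ ! c ≤[ ε ] σ ! k) (sym (loopWalk-end γ))
                  (depth-reflects ε (rank<n c) (rank<n k) (subst (depth n ε (u ! c) ≤_) (sym depth-k) (≮⇒≥ ¬deep)))

  confined-suc : ∀ r → Confined r → ¬ ¬ Confined (suc r)
  confined-suc r (α , α-start , α-end , confined) ¬next with any? (λ k → depth n ε (u ! k) ≟ r)
  ... | no absent = ¬next (α , α-start , α-end , λ c t → ≤∧≢⇒< (confined c t) (λ r≡ → absent (c , sym r≡)))
  ... | yes (k , depth-k) = K-driftless (u , u∈K , k , ε , loop-drifts)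
    where
      loop-drifts : ∀ γ → DriftIs γ k ε
      loop-drifts γ with thread? ε (loopWalk γ) (suc (len-1 γ)) k k
      ... | yes t = thread⇒drift γ (walkOf-agrees (path γ)) ε t
      ... | no ¬t = ⊥-elim (¬next (confined-append (α , α-start , α-end , confined) depth-k γ ¬t))

  confined : ∀ r → ¬ ¬ Confined r
  confined zero ¬conf = ¬conf confined-zero
  confined (suc r) ¬conf = confined r (λ conf → confined-suc r conf ¬conf)

  -- A loop γ at u yields the loop α·γ·β at v in H, whose drift produces a thread along α; at depth
  -- n there is none.  Without loops at u, K drifts vacuously.
  ¬confined-n : ¬ Confined n
  ¬confined-n (α , α-start , α-end , confined) = K-driftless (u , u∈K , j , ε , λ γ → ⊥-elim (no-loop γ))
    where
      no-loop : Loop K u → ⊥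
      no-loop γ with walk-between u v (proj₁ K⊆H u u∈K) v∈H
      ... | β , β-start , β-end = <⇒≱ (depth<n ε (rank<n w)) (confined w tα)
        where
          G = loopWalk γ
          ℓ = suc (len-1 γ)
          join₁ = trans α-end (sym (start≡ γ))
          module αG = Append α G join₁
          join₂ = trans (αG.vertʳ ℓ) (trans (loopWalk-end γ) (sym β-start))
          module αGβ = Append αG.walk β join₂
          len≡ : len αGβ.walk ≡ suc ((len α + len-1 γ) + len β)
          len≡ = cong (_+ len β) (+-suc (len α) (len-1 γ))
          loop = loopOf αGβ.walk len≡ (trans (αGβ.vertˡ 0 z≤n) (trans (αG.vertˡ 0 z≤n) α-start))
                                      (trans (αGβ.vertʳ (len β)) β-end)
          tΛ = subst (λ L → Thread ε αGβ.walk L j j) (sym len≡)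
                 (drift⇒thread loop (pathOf-agrees αGβ.walk len≡) ε (H-drifts loop))
          tαG = proj₁ (proj₂ (thread-split αG.walk β join₂ ε (len β) tΛ))
          w = proj₁ (thread-split α G join₁ ε ℓ tαG)
          tα = proj₁ (proj₂ (thread-split α G join₁ ε ℓ tαG))

  absurd : ⊥
  absurd = confined n ¬confined-n

corollary4p11 : (n : ℕ) (K H : Subgraph n) →
    StronglyConnected K → StronglyConnected H → K ⊆G H →
    Driftless K → Driftless H
corollary4p11 n K H ((u , u∈K) , _) (_ , connected) K⊆H K-driftless (v , v∈H , j , ε , H-drifts) =
  DriftTransfer.absurd K⊆H connected K-driftless v∈H j ε H-drifts u∈K
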